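{- Let \(G\) be a finite simple connected graph with \(\Delta(G)\le 4\) that is not the octahedron. Let \(T,T'\) be triangles of \(G\) with \(T\cap T'=\{x\}\), where \(T\) is an inner triangle. Then \(N(x)\) induces a 4-cycle in \(G\). Moreover, if \(T'\) is also an inner triangle, then none of the ears of \(Q_T\) is an inner triangle, and no vertex of \(T\) other than \(x\) is a normal vertex.
   Context: A clique is a maximal complete subgraph; \(K(G)\) is the intersection graph of the cliques of \(G\), \(K^2(G)=K(K(G))\). A triangle is a complete subgraph on three vertices. A triangle \(T\) is inner if \(T\) is a clique of \(G\) and for each edge \(e\) of \(T\) there is a triangle \(T'\ne T\) with \(T\cap T'=e\). For an inner triangle \(T\), \(Q_T=\{q\in K(G): |q\cap T|\ge 2\}\), and the elements of \(Q_T\) other than \(T\) are its ears. For \(x\in G\), the star \(x^*=\{q\in K(G): x\in q\}\); \(x\) is a normal vertex if \(x^*\) is a clique of \(K(G)\) (a vertex of \(K^2(G)\)). \(N(x)\) is the set of neighbors of \(x\). The octahedron is \(K_{2,2,2}\). -}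

module Defs where

open import Data.Nat using (ℕ; _≤_)
open import Data.Bool using (Bool; true; false; T; not)
open import Data.Fin using (Fin; zero; suc)
open import Data.Fin.Subset using (Subset; _∈_; _∉_; _⊆_; _∩_; ∣_∣; ⁅_⁆; Nonempty)
open import Data.Vec using (tabulate)
open import Data.Product using (Σ; ∃; _×_; _,_)
open import Data.Sum using (_⊎_)
open import Relation.Binary.PropositionalEquality using (_≡_; _≢_)
open import Relation.Nullary using (¬_)

record Graph (n : ℕ) : Set where
  field
    adj    : Fin n → Fin n → Bool
    sym    : ∀ u v → adj u v ≡ adj v u
    irrefl : ∀ u → adj u u ≡ false

module _ {n : ℕ} (G : Graph n) where
  open Graph G

  Adj : Fin n → Fin n → Set
  Adj u v = T (adj u v)

  N : Fin n → Subset n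
  N x = tabulate (adj x)

  MaxDegree≤ : ℕ → Set
  MaxDegree≤ d = ∀ v → ∣ N v ∣ ≤ d

  data Reachable : Fin n → Fin n → Set where
    here : ∀ {u} → Reachable u u
    step : ∀ {u v w} → Adj u v → Reachable v w → Reachable u w

  Connected : Set
  Connected = ∀ u v → Reachable u v

  Complete : Subset n → Set
  Complete S = ∀ u v → u ∈ S → v ∈ S → u ≢ v → Adj u v

  IsClique : Subset n → Set
  IsClique S = Complete S × (∀ S' → S ⊆ S' → Complete S' → S' ⊆ S)

  Triangle : Subset n → Set
  Triangle S = Complete S × ∣ S ∣ ≡ 3

  EdgeOf : Subset n → Subset n → Set
  EdgeOf e S = e ⊆ S × ∣ e ∣ ≡ 2

  Inner : Subset n → Set
  Inner S = Triangle S × IsClique S ×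
    (∀ e → EdgeOf e S → ∃ λ S' → Triangle S' × S' ≢ S × (S ∩ S') ≡ e)

  Ear : Subset n → Subset n → Set
  Ear S q = IsClique q × 2 ≤ ∣ q ∩ S ∣ × q ≢ S

  -- K(G): vertices are cliques of G, adjacent iff distinct and intersecting.
  -- A set of vertices of K(G) is a predicate on subsets.
  KComplete : (Subset n → Set) → Set
  KComplete P = (∀ q → P q → IsClique q) ×
    (∀ q q' → P q → P q' → q ≢ q' → Nonempty (q ∩ q'))

  KClique : (Subset n → Set) → Set₁
  KClique P = KComplete P ×
    (∀ (P' : Subset n → Set) → (∀ q → P q → P' q) → KComplete P' → ∀ q → P' q → P q)

  star : Fin n → Subset n → Set
  star x q = IsClique q × x ∈ q

  Normal : Fin n → Set₁
  Normal x = KClique (star x)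

  NbhdInducesC4 : Fin n → Set
  NbhdInducesC4 x = Σ (Fin n) λ a → Σ (Fin n) λ b → Σ (Fin n) λ c → Σ (Fin n) λ d →
    a ≢ b × a ≢ c × a ≢ d × b ≢ c × b ≢ d × c ≢ d ×
    (∀ v → Adj x v → v ≡ a ⊎ v ≡ b ⊎ v ≡ c ⊎ v ≡ d) ×
    Adj x a × Adj x b × Adj x c × Adj x d ×
    Adj a b × Adj b c × Adj c d × Adj d a × ¬ Adj a c × ¬ Adj b d

-- The octahedron K_{2,2,2} on Fin 6 with parts {0,1},{2,3},{4,5}
part : Fin 6 → Fin 3
part zero = zero
part (suc zero) = zero
part (suc (suc zero)) = suc zero
part (suc (suc (suc zero))) = suc zero
part (suc (suc (suc (suc zero)))) = suc (suc zero)
part (suc (suc (suc (suc (suc zero))))) = suc (suc zero)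

sameFin3 : Fin 3 → Fin 3 → Bool
sameFin3 zero zero = true
sameFin3 (suc zero) (suc zero) = true
sameFin3 (suc (suc zero)) (suc (suc zero)) = true
sameFin3 _ _ = false

octAdj : Fin 6 → Fin 6 → Bool
octAdj i j = not (sameFin3 (part i) (part j))

IsOctahedron : ∀ {n} → Graph n → Set
IsOctahedron {n} G = Σ (Fin n → Fin 6) λ f → Σ (Fin 6 → Fin n) λ g →
  (∀ u → g (f u) ≡ u) × (∀ i → f (g i) ≡ i) ×
  (∀ u v → Graph.adj G u v ≡ octAdj (f u) (f v))

{-# OPTIONS --safe #-}
-- Let S = xyz be the inner triangle and w, v, u the third vertices of the other triangles on xy, xz, yz.
-- Maximality of S rules out the edges zw, yv, xu, so y, z, v, w are four distinct neighbours of x and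
-- Δ ≤ 4 makes them all of N(x); S' meets S only in x, hence S' = xvw and N(x) is the 4-cycle yzvw.
-- If S' is inner, its edge vw lies in a second triangle vwt, which fills up N(w) and N(v).  Then u sees
-- neither w nor v: otherwise x u y v z w span an octahedron, which by connectivity and Δ ≤ 4 is all of G.
-- An inner ear of S would be one of xyw, xzv, yzu, but their edges yw, zv, yu lie in no other triangle.
-- Finally the clique xzv meets every clique through y (those containing u also contain z, the others
-- contain x), so the star of y is not maximal in K(G); symmetrically for z.
module Submission where

open import Data.Bool using (T; true; false)
open import Data.Bool.Properties using (T-≡; T?)
open import Data.Empty using (⊥; ⊥-elim)
open import Data.Fin using (Fin; zero; suc; _≟_; #_)
open import Data.Fin.Properties using (any?; all?)
open import Data.Fin.Subset using (Subset; _∈_; _∉_; _⊆_; _∪_; _∩_; _-_; ⁅_⁆; ∣_∣; inside; outside; Nonempty)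
open import Data.Fin.Subset.Properties
  using ( _∈?_; ⊆-antisym; ∩-comm; p⊆p∪q; x∈p∪q⁺; x∈p∪q⁻; x∈p∩q⁺; x∈p∩q⁻; x∈⁅x⁆; x∈⁅y⁆⇒x≡y
        ; x∈p∧x≢y⇒x∈p-y; x∈p⇒∣p-x∣<∣p∣; p─q⊆p; p─⊥≡p; Empty-unique; ∣⊥∣≡0)
open import Data.List using (List; []; _∷_; length; map; filter; allFin)
open import Data.List.Properties using (length-map)
open import Data.List.Membership.Propositional using () renaming (_∈_ to _∈ₗ_; _∉_ to _∉ₗ_)
open import Data.List.Membership.Propositional.Properties using (∈-map⁻; ∈-filter⁻)
import Data.List.Membership.DecPropositional as DecMembership
open import Data.List.Relation.Unary.All using (All; []; _∷_)
import Data.List.Relation.Unary.All as All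
open import Data.List.Relation.Unary.All.Properties using (¬Any⇒All¬; all-filter) renaming (map⁺ to All-map⁺)
open import Data.List.Relation.Unary.AllPairs using ([]; _∷_)
open import Data.List.Relation.Unary.Any using (here; there)
open import Data.List.Relation.Unary.Unique.Propositional using (Unique)
import Data.List.Relation.Unary.Unique.Propositional.Properties as Unique
open import Data.Nat using (ℕ; suc; _≤_; _<_; z≤n; s≤s)
import Data.Nat as ℕ
open import Data.Nat.Properties using (≤-reflexive; ≤-antisym; ≤-trans; ≤-refl; m≤n⇒m≤1+n; <-irrefl)
open import Data.Product using (∃; ∃₂; _×_; _,_; proj₁; proj₂; uncurry)
open import Data.Product.Properties using () renaming (≡-dec to ×-≡-dec)
open import Data.Sum using (_⊎_; inj₁; inj₂)
open import Data.Vec using ([]; _∷_; here; there; lookup)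
open import Data.Vec.Properties using (lookup∘tabulate; lookup⇒[]=; []=⇒lookup)
open import Function using (_∘_; case_of_)
open import Function.Bundles using (Equivalence)
open import Relation.Binary.PropositionalEquality using (_≡_; _≢_; refl; sym; trans; cong; subst; subst₂)
open import Relation.Nullary using (¬_; ¬?; Dec; yes; no; _×-dec_)
open import Relation.Nullary.Decidable using (toWitness; _→-dec_; _⊎-dec_; dec-true; dec-false)

open import Defs

private
  variable
    n : ℕ

x∉p-x : ∀ (x : Fin n) (p : Subset n) → x ∉ p - x
x∉p-x zero    (inside  ∷ p) ()
x∉p-x zero    (outside ∷ p) ()
x∉p-x (suc x) (s ∷ p) (there x∈p-x) = x∉p-x x p x∈p-x

x∈p⇒∣p∣≡1+∣p-x∣ : ∀ {x : Fin n} {p} → x ∈ p → ∣ p ∣ ≡ suc ∣ p - x ∣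
x∈p⇒∣p∣≡1+∣p-x∣ {p = inside ∷ p}  here        = cong (λ q → suc ∣ q ∣) (sym (p─⊥≡p p))
x∈p⇒∣p∣≡1+∣p-x∣ {p = inside ∷ p}  (there x∈p) = cong suc (x∈p⇒∣p∣≡1+∣p-x∣ x∈p)
x∈p⇒∣p∣≡1+∣p-x∣ {p = outside ∷ p} (there x∈p) = x∈p⇒∣p∣≡1+∣p-x∣ x∈p

⊆⇒∣p∣≤length : ∀ {p : Subset n} xs → (∀ {v} → v ∈ p → v ∈ₗ xs) → ∣ p ∣ ≤ length xs
⊆⇒∣p∣≤length {n} [] p⊆[] =
  ≤-reflexive (trans (cong ∣_∣ (Empty-unique λ { (_ , v∈p) → case p⊆[] v∈p of λ () })) (∣⊥∣≡0 n))
⊆⇒∣p∣≤length {p = p} (x ∷ xs) p⊆x∷xs with x ∈? p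
... | yes x∈p rewrite x∈p⇒∣p∣≡1+∣p-x∣ x∈p = s≤s (⊆⇒∣p∣≤length xs p-x⊆xs)
  where
  p-x⊆xs : ∀ {v} → v ∈ p - x → v ∈ₗ xs
  p-x⊆xs {v} v∈p-x with p⊆x∷xs (p─q⊆p p _ v∈p-x)
  ... | here refl  = ⊥-elim (x∉p-x x p v∈p-x)
  ... | there v∈xs = v∈xs
... | no x∉p = m≤n⇒m≤1+n (⊆⇒∣p∣≤length xs p⊆xs)
  where
  p⊆xs : ∀ {v} → v ∈ p → v ∈ₗ xs
  p⊆xs v∈p with p⊆x∷xs v∈p
  ... | here refl  = ⊥-elim (x∉p v∈p)
  ... | there v∈xs = v∈xs

_∈ₗ?_ : ∀ (v : Fin n) xs → Dec (v ∈ₗ xs)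
_∈ₗ?_ = DecMembership._∈?_ _≟_

⊆⇒length≤∣p∣ : ∀ {p : Subset n} {xs} → Unique xs → All (_∈ p) xs → length xs ≤ ∣ p ∣
⊆⇒length≤∣p∣ [] [] = z≤n
⊆⇒length≤∣p∣ (x∉xs ∷ xs!) (x∈p ∷ xs⊆p) =
  ≤-trans (s≤s (⊆⇒length≤∣p∣ xs! (All.zipWith (λ (v∈p , x≢v) → x∈p∧x≢y⇒x∈p-y v∈p (x≢v ∘ sym)) (xs⊆p , x∉xs))))
          (x∈p⇒∣p-x∣<∣p∣ x∈p)

∣p∣≤length⇒⊆ : ∀ {p : Subset n} {xs v} → ∣ p ∣ ≤ length xs → Unique xs → All (_∈ p) xs → v ∈ p → v ∈ₗ xs
∣p∣≤length⇒⊆ {xs = xs} {v} ∣p∣≤ xs! xs⊆p v∈p with v ∈ₗ? xs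
... | yes v∈xs = v∈xs
... | no  v∉xs = ⊥-elim (<-irrefl refl (≤-trans (⊆⇒length≤∣p∣ (¬Any⇒All¬ xs v∉xs ∷ xs!) (v∈p ∷ xs⊆p)) ∣p∣≤))

length<∣p∣⇒∃∉ : ∀ {p : Subset n} xs → length xs < ∣ p ∣ → ∃ λ v → v ∈ p × v ∉ₗ xs
length<∣p∣⇒∃∉ {p = p} xs len< with any? (λ v → v ∈? p ×-dec ¬? (v ∈ₗ? xs))
... | yes found = found
... | no ∄ = ⊥-elim (<-irrefl refl (≤-trans len< (⊆⇒∣p∣≤length xs p⊆xs)))
  where
  p⊆xs : ∀ {v} → v ∈ p → v ∈ₗ xs
  p⊆xs {v} v∈p with v ∈ₗ? xs
  ... | yes v∈xs = v∈xs
  ... | no  v∉xs = ⊥-elim (∄ (v , v∈p , v∉xs))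

two-elements : ∀ {p : Subset n} → 2 ≤ ∣ p ∣ → ∃₂ λ a b → a ∈ p × b ∈ p × a ≢ b
two-elements 2≤∣p∣ with length<∣p∣⇒∃∉ [] (≤-trans (s≤s z≤n) 2≤∣p∣)
... | a , a∈p , _ with length<∣p∣⇒∃∉ (a ∷ []) 2≤∣p∣
...   | b , b∈p , b∉[a] = a , b , a∈p , b∈p , λ a≡b → b∉[a] (here (sym a≡b))

∈∧∉⇒≢ : ∀ {p : Subset n} {a b} → a ∈ p → b ∉ p → a ≢ b
∈∧∉⇒≢ a∈p b∉p refl = b∉p a∈p

∩≡⁅x⁆⇒x∈ : ∀ {p q : Subset n} {x} → p ∩ q ≡ ⁅ x ⁆ → x ∈ p × x ∈ q
∩≡⁅x⁆⇒x∈ {p = p} {q} {x} p∩q≡x = x∈p∩q⁻ p q (subst (x ∈_) (sym p∩q≡x) (x∈⁅x⁆ x))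

∩≡⁅x⁆⇒∉ : ∀ {p q : Subset n} {x r} → p ∩ q ≡ ⁅ x ⁆ → r ∈ q → x ≢ r → r ∉ p
∩≡⁅x⁆⇒∉ {x = x} p∩q≡x r∈q x≢r r∈p = x≢r (sym (x∈⁅y⁆⇒x≡y x (subst (_ ∈_) p∩q≡x (x∈p∩q⁺ (r∈p , r∈q)))))

infix 4 _≐_

record _≐_ (p : Subset n) (xs : List (Fin n)) : Set where
  field
    distinct : Unique xs
    sound    : All (_∈ p) xs
    complete : ∀ {v} → v ∈ p → v ∈ₗ xs

open _≐_ public

≐-swap₂₃ : ∀ {p : Subset n} {a b c} → p ≐ a ∷ b ∷ c ∷ [] → p ≐ a ∷ c ∷ b ∷ []
≐-swap₂₃ {a = a} {b} {c} record
  { distinct = (a≢b ∷ a≢c ∷ []) ∷ (b≢c ∷ []) ∷ [] ∷ [] ; sound = a∈p ∷ b∈p ∷ c∈p ∷ [] ; complete = p⊆abc } =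
  record
  { distinct = (a≢c ∷ a≢b ∷ []) ∷ ((b≢c ∘ sym) ∷ []) ∷ [] ∷ []
  ; sound    = a∈p ∷ c∈p ∷ b∈p ∷ []
  ; complete = swap ∘ p⊆abc
  }
  where
  swap : ∀ {v} → v ∈ₗ a ∷ b ∷ c ∷ [] → v ∈ₗ a ∷ c ∷ b ∷ []
  swap (here v≡a)                 = here v≡a
  swap (there (here v≡b))         = there (there (here v≡b))
  swap (there (there (here v≡c))) = there (here v≡c)

≐⇒∣p∣≡length : ∀ {p : Subset n} {xs} → p ≐ xs → ∣ p ∣ ≡ length xs
≐⇒∣p∣≡length {xs = xs} p≐xs =
  ≤-antisym (⊆⇒∣p∣≤length xs (complete p≐xs)) (⊆⇒length≤∣p∣ (distinct p≐xs) (sound p≐xs))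

⁅a⁆∪⁅b⁆≐ : ∀ {a b : Fin n} → a ≢ b → ⁅ a ⁆ ∪ ⁅ b ⁆ ≐ a ∷ b ∷ []
⁅a⁆∪⁅b⁆≐ {a = a} {b} a≢b = record
  { distinct = (a≢b ∷ []) ∷ [] ∷ []
  ; sound    = x∈p∪q⁺ (inj₁ (x∈⁅x⁆ a)) ∷ x∈p∪q⁺ (inj₂ (x∈⁅x⁆ b)) ∷ []
  ; complete = one-of ∘ x∈p∪q⁻ ⁅ a ⁆ ⁅ b ⁆
  }
  where
  one-of : ∀ {v} → v ∈ ⁅ a ⁆ ⊎ v ∈ ⁅ b ⁆ → v ∈ₗ a ∷ b ∷ []
  one-of (inj₁ v∈a) = here (x∈⁅y⁆⇒x≡y a v∈a)
  one-of (inj₂ v∈b) = there (here (x∈⁅y⁆⇒x≡y b v∈b))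

octahedron-edges : List (Fin 6 × Fin 6)
octahedron-edges =
  (# 0 , # 2) ∷ (# 0 , # 3) ∷ (# 0 , # 4) ∷ (# 0 , # 5) ∷ (# 1 , # 2) ∷ (# 1 , # 3) ∷
  (# 1 , # 4) ∷ (# 1 , # 5) ∷ (# 2 , # 4) ∷ (# 2 , # 5) ∷ (# 3 , # 4) ∷ (# 3 , # 5) ∷ []

octahedron-antipodes : List (Fin 6 × Fin 6)
octahedron-antipodes = (# 0 , # 1) ∷ (# 2 , # 3) ∷ (# 4 , # 5) ∷ []

octahedron-neighbours : Fin 6 → List (Fin 6)
octahedron-neighbours i = filter (T? ∘ octAdj i) (allFin 6)

_∈ₚ?_ : ∀ (ij : Fin 6 × Fin 6) ps → Dec (ij ∈ₗ ps)
_∈ₚ?_ = DecMembership._∈?_ (×-≡-dec _≟_ _≟_)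

octAdj⇒edge : ∀ i j → T (octAdj i j) → (i , j) ∈ₗ octahedron-edges ⊎ (j , i) ∈ₗ octahedron-edges
octAdj⇒edge = toWitness {a? = all? λ i → all? λ j →
  T? (octAdj i j) →-dec ((i , j) ∈ₚ? octahedron-edges ⊎-dec (j , i) ∈ₚ? octahedron-edges)} _

¬octAdj⇒antipodes : ∀ i j → ¬ T (octAdj i j) → i ≢ j →
  (i , j) ∈ₗ octahedron-antipodes ⊎ (j , i) ∈ₗ octahedron-antipodes
¬octAdj⇒antipodes = toWitness {a? = all? λ i → all? λ j →
  ¬? (T? (octAdj i j)) →-dec ¬? (i ≟ j) →-dec
  ((i , j) ∈ₚ? octahedron-antipodes ⊎-dec (j , i) ∈ₚ? octahedron-antipodes)} _

octahedron-4-regular : ∀ i → length (octahedron-neighbours i) ≡ 4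
octahedron-4-regular = toWitness {a? = all? λ i → length (octahedron-neighbours i) ℕ.≟ 4} _

module _ {n} (G : Graph n) where
  open Graph G using (adj; irrefl)

  Adj-sym : ∀ {a b} → Adj G a b → Adj G b a
  Adj-sym {a} {b} = subst T (Graph.sym G a b)

  Adj⇒≢ : ∀ {a b} → Adj G a b → a ≢ b
  Adj⇒≢ {a} Aaa refl = subst T (irrefl a) Aaa

  Adj-≢ : ∀ {a b c} → Adj G a b → ¬ Adj G a c → b ≢ c
  Adj-≢ Aab ¬Aac refl = ¬Aac Aab

  Adj⇒∈N : ∀ {v a} → Adj G v a → a ∈ N G v
  Adj⇒∈N {v} {a} Ava = lookup⇒[]= a (N G v) (trans (lookup∘tabulate (adj v) a) (Equivalence.to T-≡ Ava))

  ∈N⇒Adj : ∀ {v a} → a ∈ N G v → Adj G v a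
  ∈N⇒Adj {v} {a} a∈N = Equivalence.from T-≡ (trans (sym (lookup∘tabulate (adj v) a)) ([]=⇒lookup a∈N))

  neighbourhood-listed : ∀ {d v xs} → MaxDegree≤ G d → d ≤ length xs → Unique xs → All (Adj G v) xs →
    N G v ≐ xs
  neighbourhood-listed {v = v} deg d≤len xs! Avxs = record
    { distinct = xs!
    ; sound    = xs⊆N
    ; complete = ∣p∣≤length⇒⊆ (≤-trans (deg v) d≤len) xs! xs⊆N
    }
    where xs⊆N = All.map Adj⇒∈N Avxs

  listed-neighbour : ∀ {v r xs} → N G v ≐ xs → Adj G v r → r ∈ₗ xs
  listed-neighbour N≐ = complete N≐ ∘ Adj⇒∈N

  nbhd-4-cycle : ∀ {x a b c d} → N G x ≐ a ∷ b ∷ c ∷ d ∷ [] →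
    Adj G a b → Adj G b c → Adj G c d → Adj G d a → ¬ Adj G a c → ¬ Adj G b d → NbhdInducesC4 G x
  nbhd-4-cycle {a = a} {b} {c} {d} record
    { distinct = (a≢b ∷ a≢c ∷ a≢d ∷ []) ∷ (b≢c ∷ b≢d ∷ []) ∷ (c≢d ∷ []) ∷ [] ∷ []
    ; sound    = a∈N ∷ b∈N ∷ c∈N ∷ d∈N ∷ []
    ; complete = N⊆abcd
    } Aab Abc Acd Ada ¬Aac ¬Abd =
    a , b , c , d , a≢b , a≢c , a≢d , b≢c , b≢d , c≢d , (λ r → one-of ∘ N⊆abcd ∘ Adj⇒∈N) ,
    ∈N⇒Adj a∈N , ∈N⇒Adj b∈N , ∈N⇒Adj c∈N , ∈N⇒Adj d∈N , Aab , Abc , Acd , Ada , ¬Aac , ¬Abd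
    where
    one-of : ∀ {r} → r ∈ₗ a ∷ b ∷ c ∷ d ∷ [] → r ≡ a ⊎ r ≡ b ⊎ r ≡ c ⊎ r ≡ d
    one-of (here r≡a)                         = inj₁ r≡a
    one-of (there (here r≡b))                 = inj₂ (inj₁ r≡b)
    one-of (there (there (here r≡c)))         = inj₂ (inj₂ (inj₁ r≡c))
    one-of (there (there (there (here r≡d)))) = inj₂ (inj₂ (inj₂ r≡d))

  triangle-listed : ∀ {S a b} → Triangle G S → a ∈ S → b ∈ S → a ≢ b → ∃ λ c → S ≐ a ∷ b ∷ c ∷ []
  triangle-listed {a = a} {b} (_ , ∣S∣≡3) a∈S b∈S a≢b
    with length<∣p∣⇒∃∉ (a ∷ b ∷ []) (≤-reflexive (sym ∣S∣≡3))
  ... | c , c∈S , c∉ab = c , record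
    { distinct = abc!
    ; sound    = a∈S ∷ b∈S ∷ c∈S ∷ []
    ; complete = ∣p∣≤length⇒⊆ (≤-reflexive ∣S∣≡3) abc! (a∈S ∷ b∈S ∷ c∈S ∷ [])
    }
    where
    abc! : Unique (a ∷ b ∷ c ∷ [])
    abc! = (a≢b ∷ (λ a≡c → c∉ab (here (sym a≡c))) ∷ [])
         ∷ ((λ b≡c → c∉ab (there (here (sym b≡c)))) ∷ [])
         ∷ [] ∷ []

  triangle-through : ∀ {S a} → Triangle G S → a ∈ S → ∃₂ λ b c → S ≐ a ∷ b ∷ c ∷ []
  triangle-through {a = a} t@(_ , ∣S∣≡3) a∈S
    with length<∣p∣⇒∃∉ (a ∷ []) (subst (2 ≤_) (sym ∣S∣≡3) (s≤s (s≤s z≤n)))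
  ... | b , b∈S , b∉[a] = b , triangle-listed t a∈S b∈S (λ a≡b → b∉[a] (here (sym a≡b)))

  triangle-edges : ∀ {S a b c} → Complete G S → S ≐ a ∷ b ∷ c ∷ [] → Adj G a b × Adj G a c × Adj G b c
  triangle-edges S-complete record
    { distinct = (a≢b ∷ a≢c ∷ []) ∷ (b≢c ∷ []) ∷ [] ∷ []
    ; sound    = a∈S ∷ b∈S ∷ c∈S ∷ []
    } = S-complete _ _ a∈S b∈S a≢b , S-complete _ _ a∈S c∈S a≢c , S-complete _ _ b∈S c∈S b≢c

  clique-absorbs : ∀ {S t} → IsClique G S → (∀ {s} → s ∈ S → s ≢ t → Adj G t s) → t ∈ S
  clique-absorbs {S} {t} (S-complete , S-maximal) Ats =
    S-maximal (S ∪ ⁅ t ⁆) (p⊆p∪q ⁅ t ⁆) S+t-complete (x∈p∪q⁺ (inj₂ (x∈⁅x⁆ t)))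
    where
    S+t-complete : Complete G (S ∪ ⁅ t ⁆)
    S+t-complete a b a∈ b∈ a≢b with x∈p∪q⁻ S ⁅ t ⁆ a∈ | x∈p∪q⁻ S ⁅ t ⁆ b∈
    ... | inj₁ a∈S | inj₁ b∈S = S-complete a b a∈S b∈S a≢b
    ... | inj₁ a∈S | inj₂ b∈t rewrite x∈⁅y⁆⇒x≡y t b∈t = Adj-sym (Ats a∈S a≢b)
    ... | inj₂ a∈t | inj₁ b∈S rewrite x∈⁅y⁆⇒x≡y t a∈t = Ats b∈S (a≢b ∘ sym)
    ... | inj₂ a∈t | inj₂ b∈t = ⊥-elim (a≢b (trans (x∈⁅y⁆⇒x≡y t a∈t) (sym (x∈⁅y⁆⇒x≡y t b∈t))))

  listed-clique-absorbs : ∀ {S t xs} → IsClique G S → (∀ {s} → s ∈ S → s ∈ₗ xs) → All (Adj G t) xs →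
    t ∈ S
  listed-clique-absorbs S-clique S⊆xs Atxs = clique-absorbs S-clique λ s∈S _ → All.lookup Atxs (S⊆xs s∈S)

  clique-⊆-complete : ∀ {q S} → IsClique G q → Complete G S → q ⊆ S → q ≡ S
  clique-⊆-complete (_ , q-maximal) S-complete q⊆S = ⊆-antisym q⊆S (q-maximal _ q⊆S S-complete)

  listed-clique : ∀ {S xs} → Complete G S → S ≐ xs → (∀ r → ¬ All (Adj G r) xs) → IsClique G S
  listed-clique {S} {xs} S-complete S≐ no-common-neighbour = S-complete , S-maximal
    where
    S-maximal : ∀ S' → S ⊆ S' → Complete G S' → S' ⊆ S
    S-maximal S' S⊆S' S'-complete {r} r∈S' with r ∈ₗ? xs
    ... | yes r∈xs = All.lookup (sound S≐) r∈xs
    ... | no  r∉xs = ⊥-elim (no-common-neighbour r (All.tabulate λ s∈xs →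
          S'-complete _ _ r∈S' (S⊆S' (All.lookup (sound S≐) s∈xs)) λ { refl → r∉xs s∈xs }))

  inner-edge-apex : ∀ {S a b} → Inner G S → a ∈ S → b ∈ S → a ≢ b →
    ∃₂ λ S₁ c → Complete G S₁ × S₁ ≐ a ∷ b ∷ c ∷ [] × c ∉ S
  inner-edge-apex {S} {a} {b} (_ , _ , edges-shared) a∈S b∈S a≢b
    with edges-shared (⁅ a ⁆ ∪ ⁅ b ⁆) (ab⊆S , ≐⇒∣p∣≡length ab≐)
    where
    ab≐ = ⁅a⁆∪⁅b⁆≐ a≢b
    ab⊆S : ⁅ a ⁆ ∪ ⁅ b ⁆ ⊆ S
    ab⊆S v∈ab with complete ab≐ v∈ab
    ... | here refl         = a∈S
    ... | there (here refl) = b∈S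
  ... | S₁ , S₁-triangle , _ , S∩S₁≡ab
    with triangle-listed S₁-triangle (in-S₁ (here refl)) (in-S₁ (there (here refl))) a≢b
    where
    in-S₁ : ∀ {v} → v ∈ₗ a ∷ b ∷ [] → v ∈ S₁
    in-S₁ v∈ab = proj₂ (x∈p∩q⁻ S S₁ (subst (_ ∈_) (sym S∩S₁≡ab) (All.lookup (sound (⁅a⁆∪⁅b⁆≐ a≢b)) v∈ab)))
  ... | c , S₁≐ = S₁ , c , proj₁ S₁-triangle , S₁≐ , c∉S
    where
    c∉S : c ∉ S
    c∉S c∈S with distinct S₁≐ | complete (⁅a⁆∪⁅b⁆≐ a≢b) (subst (c ∈_) S∩S₁≡ab (x∈p∩q⁺ (c∈S , c∈S₁)))
      where c∈S₁ = All.lookup (sound S₁≐) (there (there (here refl)))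
    ... | (_ ∷ a≢c ∷ []) ∷ _ | here c≡a        = a≢c (sym c≡a)
    ... | _ ∷ (b≢c ∷ []) ∷ _ | there (here c≡b) = b≢c (sym c≡b)

  private-edge⇒¬Inner : ∀ {q a b} → a ∈ q → b ∈ q → a ≢ b → (∀ {s} → Adj G a s → Adj G b s → s ∈ q) →
    ¬ Inner G q
  private-edge⇒¬Inner a∈q b∈q a≢b ab-private iq with inner-edge-apex iq a∈q b∈q a≢b
  ... | _ , _ , S₁-complete , S₁≐ , c∉q with triangle-edges S₁-complete S₁≐
  ... | _ , Aac , Abc = c∉q (ab-private Aac Abc)

  module Octahedron (conn : Connected G) (deg : MaxDegree≤ G 4) (g : Fin 6 → Fin n)
    (edges : All (uncurry λ i j → Adj G (g i) (g j)) octahedron-edges)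
    (antipodes-apart : All (uncurry λ i j → g i ≢ g j) octahedron-antipodes) where

    g-adjacent : ∀ i j → T (octAdj i j) → Adj G (g i) (g j)
    g-adjacent i j ij with octAdj⇒edge i j ij
    ... | inj₁ ij∈ = All.lookup edges ij∈
    ... | inj₂ ji∈ = Adj-sym (All.lookup edges ji∈)

    g-injective : ∀ {i j} → g i ≡ g j → i ≡ j
    g-injective {i} {j} gi≡gj with i ≟ j | T? (octAdj i j)
    ... | yes i≡j | _      = i≡j
    ... | no  _   | yes ij = ⊥-elim (Adj⇒≢ (g-adjacent i j ij) gi≡gj)
    ... | no  i≢j | no ¬ij with ¬octAdj⇒antipodes i j ¬ij i≢j
    ...   | inj₁ ij∈ = ⊥-elim (All.lookup antipodes-apart ij∈ gi≡gj)
    ...   | inj₂ ji∈ = ⊥-elim (All.lookup antipodes-apart ji∈ (sym gi≡gj))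

    N[g]≐ : ∀ i → N G (g i) ≐ map g (octahedron-neighbours i)
    N[g]≐ i = neighbourhood-listed deg
      (≤-reflexive (sym (trans (length-map g (octahedron-neighbours i)) (octahedron-4-regular i))))
      (Unique.map⁺ g-injective (Unique.filter⁺ (T? ∘ octAdj i) (Unique.allFin⁺ 6)))
      (All-map⁺ (All.map (g-adjacent i _) (all-filter (T? ∘ octAdj i) (allFin 6))))

    g-adj : ∀ i j → adj (g i) (g j) ≡ octAdj i j
    g-adj i j with octAdj i j in eq
    ... | true  = dec-true (T? _) (g-adjacent i j (subst T (sym eq) _))
    ... | false = dec-false (T? _) (not-neighbour ∘ ∈-map⁻ g ∘ listed-neighbour (N[g]≐ i))
      where
      -- g i already has its four octahedron neighbours, so the degree bound leaves no room for g j.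
      not-neighbour : (∃ λ k → k ∈ₗ octahedron-neighbours i × g j ≡ g k) → ⊥
      not-neighbour (k , k∈ , gj≡gk) with g-injective gj≡gk
      ... | refl = subst T eq (proj₂ (∈-filter⁻ (T? ∘ octAdj i) k∈))

    g-surjective : ∀ r → ∃ λ i → g i ≡ r
    g-surjective r = along (conn (g zero) r) (zero , refl)
      where
      along : ∀ {s r} → Reachable G s r → ∃ (λ i → g i ≡ s) → ∃ λ i → g i ≡ r
      along here            reached  = reached
      along (step Ast path) (i , refl) with ∈-map⁻ g (listed-neighbour (N[g]≐ i) Ast)
      ... | j , _ , t≡gj = along path (j , sym t≡gj)

    isOctahedron : IsOctahedron G
    isOctahedron = f , g , proj₂ ∘ g-surjective , (λ i → g-injective (proj₂ (g-surjective (g i)))) , adj-f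
      where
      f = proj₁ ∘ g-surjective
      adj-f : ∀ r s → adj r s ≡ octAdj (f r) (f s)
      adj-f r s = subst₂ (λ r' s' → adj r' s' ≡ octAdj (f r) (f s))
        (proj₂ (g-surjective r)) (proj₂ (g-surjective s)) (g-adj (f r) (f s))

  record Frame (S : Subset n) (x : Fin n) : Set where
    field
      y z w v u    : Fin n
      S≐           : S ≐ x ∷ y ∷ z ∷ []
      S-clique     : IsClique G S
      Sxy Sxz      : Subset n
      Sxy≐         : Sxy ≐ x ∷ y ∷ w ∷ []
      Sxy-complete : Complete G Sxy
      Sxz≐         : Sxz ≐ x ∷ z ∷ v ∷ []
      Sxz-complete : Complete G Sxz
      w∉S          : w ∉ S
      v∉S          : v ∉ S
      u∉S          : u ∉ S
      Axy          : Adj G x y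
      Axz          : Adj G x z
      Ayz          : Adj G y z
      Axw          : Adj G x w
      Ayw          : Adj G y w
      Axv          : Adj G x v
      Azv          : Adj G z v
      Ayu          : Adj G y u
      Azu          : Adj G z u

  frame : ∀ {S x} → Inner G S → x ∈ S → Frame S x
  frame S-inner@((S-complete , _) , S-clique , _) x∈S with triangle-through (proj₁ S-inner) x∈S
  ... | y , z , S≐ with triangle-edges S-complete S≐ | sound S≐
  ... | Axy , Axz , Ayz | _ ∷ y∈S ∷ z∈S ∷ []
    with inner-edge-apex S-inner x∈S y∈S (Adj⇒≢ Axy)
       | inner-edge-apex S-inner x∈S z∈S (Adj⇒≢ Axz)
       | inner-edge-apex S-inner y∈S z∈S (Adj⇒≢ Ayz)
  ... | Sxy , w , Sxy-complete , Sxy≐ , w∉S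
      | Sxz , v , Sxz-complete , Sxz≐ , v∉S
      | _   , u , Syz-complete , Syz≐ , u∉S
    with triangle-edges Sxy-complete Sxy≐ | triangle-edges Sxz-complete Sxz≐
       | triangle-edges Syz-complete Syz≐
  ... | _ , Axw , Ayw | _ , Axv , Azv | _ , Ayu , Azu = record
    { y = y ; z = z ; w = w ; v = v ; u = u ; S≐ = S≐ ; S-clique = S-clique
    ; Sxy = Sxy ; Sxy≐ = Sxy≐ ; Sxy-complete = Sxy-complete
    ; Sxz = Sxz ; Sxz≐ = Sxz≐ ; Sxz-complete = Sxz-complete
    ; w∉S = w∉S ; v∉S = v∉S ; u∉S = u∉S
    ; Axy = Axy ; Axz = Axz ; Ayz = Ayz ; Axw = Axw ; Ayw = Ayw
    ; Axv = Axv ; Azv = Azv ; Ayu = Ayu ; Azu = Azu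
    }

  mirror : ∀ {S x} → Frame S x → Frame S x
  mirror F = record
    { y = z ; z = y ; w = v ; v = w ; u = u ; S≐ = ≐-swap₂₃ S≐ ; S-clique = S-clique
    ; Sxy = Sxz ; Sxy≐ = Sxz≐ ; Sxy-complete = Sxz-complete
    ; Sxz = Sxy ; Sxz≐ = Sxy≐ ; Sxz-complete = Sxy-complete
    ; w∉S = v∉S ; v∉S = w∉S ; u∉S = u∉S
    ; Axy = Axz ; Axz = Axy ; Ayz = Adj-sym Ayz ; Axw = Axv ; Ayw = Azv
    ; Axv = Axw ; Azv = Ayw ; Ayu = Azu ; Azu = Ayu
    }
    where open Frame F

  module FrameLemmas (deg : MaxDegree≤ G 4) {S x} (F : Frame S x) where
    open Frame F

    S∋ : ∀ {r} → r ∈ₗ x ∷ y ∷ z ∷ [] → r ∈ S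
    S∋ = All.lookup (sound S≐)

    x∈S : x ∈ S
    x∈S = S∋ (here refl)

    y∈S : y ∈ S
    y∈S = S∋ (there (here refl))

    z∈S : z ∈ S
    z∈S = S∋ (there (there (here refl)))

    S-absorbs : ∀ {t} → Adj G t x → Adj G t y → Adj G t z → t ∈ S
    S-absorbs Atx Aty Atz = listed-clique-absorbs S-clique (complete S≐) (Atx ∷ Aty ∷ Atz ∷ [])

    ¬Azw : ¬ Adj G z w
    ¬Azw Azw = w∉S (S-absorbs (Adj-sym Axw) (Adj-sym Ayw) (Adj-sym Azw))

    ¬Ayv : ¬ Adj G y v
    ¬Ayv Ayv = v∉S (S-absorbs (Adj-sym Axv) (Adj-sym Ayv) (Adj-sym Azv))

    ¬Axu : ¬ Adj G x u
    ¬Axu Axu = u∉S (S-absorbs (Adj-sym Axu) (Adj-sym Ayu) (Adj-sym Azu))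

    N[x]≐ : N G x ≐ y ∷ z ∷ v ∷ w ∷ []
    N[x]≐ = neighbourhood-listed deg ≤-refl
      ((Adj⇒≢ Ayz ∷ ∈∧∉⇒≢ y∈S v∉S ∷ Adj⇒≢ Ayw ∷ []) ∷
       (Adj⇒≢ Azv ∷ ∈∧∉⇒≢ z∈S w∉S ∷ []) ∷
       ((Adj-≢ Ayw ¬Ayv ∘ sym) ∷ []) ∷ [] ∷ [])
      (Axy ∷ Axz ∷ Axv ∷ Axw ∷ [])

    N[y]≐ : N G y ≐ x ∷ z ∷ w ∷ u ∷ []
    N[y]≐ = neighbourhood-listed deg ≤-refl
      ((Adj⇒≢ Axz ∷ Adj⇒≢ Axw ∷ ∈∧∉⇒≢ x∈S u∉S ∷ []) ∷
       (∈∧∉⇒≢ z∈S w∉S ∷ Adj⇒≢ Azu ∷ []) ∷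
       ((Adj-≢ Azu ¬Azw ∘ sym) ∷ []) ∷ [] ∷ [])
      (Adj-sym Axy ∷ Ayz ∷ Ayw ∷ Ayu ∷ [])

    second-triangle-listed : ∀ {S'} → Triangle G S' → S ∩ S' ≡ ⁅ x ⁆ → S' ≐ x ∷ v ∷ w ∷ []
    second-triangle-listed S'-triangle S∩S'≡x
      with triangle-through S'-triangle (proj₂ (∩≡⁅x⁆⇒x∈ S∩S'≡x))
    ... | a , b , S'≐ with triangle-edges (proj₁ S'-triangle) S'≐ | sound S'≐ | distinct S'≐
    ... | Axa , Axb , _ | _ ∷ a∈S' ∷ b∈S' ∷ [] | (x≢a ∷ x≢b ∷ []) ∷ (a≢b ∷ []) ∷ _
      with outside-S Axa (∩≡⁅x⁆⇒∉ S∩S'≡x a∈S' x≢a) | outside-S Axb (∩≡⁅x⁆⇒∉ S∩S'≡x b∈S' x≢b)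
      where
      outside-S : ∀ {r} → Adj G x r → r ∉ S → r ≡ v ⊎ r ≡ w
      outside-S Axr r∉S with listed-neighbour N[x]≐ Axr
      ... | here refl                         = ⊥-elim (r∉S y∈S)
      ... | there (here refl)                 = ⊥-elim (r∉S z∈S)
      ... | there (there (here r≡v))          = inj₁ r≡v
      ... | there (there (there (here r≡w))) = inj₂ r≡w
    ... | inj₁ refl | inj₂ refl = S'≐
    ... | inj₂ refl | inj₁ refl = ≐-swap₂₃ S'≐
    ... | inj₁ refl | inj₁ refl = ⊥-elim (a≢b refl)
    ... | inj₂ refl | inj₂ refl = ⊥-elim (a≢b refl)

    N[x]-4-cycle : Adj G v w → NbhdInducesC4 G x
    N[x]-4-cycle Avw = nbhd-4-cycle N[x]≐ Ayz Azv Avw (Adj-sym Ayw) ¬Ayv ¬Azw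

    octahedral : Connected G → Adj G v w → Adj G u w → Adj G u v → IsOctahedron G
    octahedral conn Avw Auw Auv =
      Octahedron.isOctahedron conn deg (lookup (x ∷ u ∷ y ∷ v ∷ z ∷ w ∷ []))
      (Axy ∷ Axv ∷ Axz ∷ Axw ∷ Adj-sym Ayu ∷ Auv ∷ Adj-sym Azu ∷ Auw ∷ Ayz ∷ Ayw ∷ Adj-sym Azv ∷ Avw ∷ [])
      (∈∧∉⇒≢ x∈S u∉S ∷ ∈∧∉⇒≢ y∈S v∉S ∷ ∈∧∉⇒≢ z∈S w∉S ∷ [])

    -- The fourth neighbour of w is the apex t over vw; were it u, then u would see v as well.
    u-misses-w : Connected G → ¬ IsOctahedron G → ∀ {S'} → Inner G S' → S' ≐ x ∷ v ∷ w ∷ [] →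
      ¬ Adj G u w
    u-misses-w conn ¬octahedron S'-inner S'≐ Auw
      with triangle-edges (proj₁ (proj₁ S'-inner)) S'≐ | sound S'≐
    ... | _ , _ , Avw | x∈S' ∷ v∈S' ∷ w∈S' ∷ []
      with inner-edge-apex S'-inner w∈S' v∈S' (Adj⇒≢ (Adj-sym Avw))
    ... | _ , t , S₁-complete , S₁≐ , t∉S' with triangle-edges S₁-complete S₁≐
    ... | _ , Awt , Avt with listed-neighbour (N[w]≐ Awt Avt (∈∧∉⇒≢ x∈S' t∉S')) (Adj-sym Auw)
      where
      N[w]≐ : ∀ {t} → Adj G w t → Adj G v t → x ≢ t → N G w ≐ x ∷ y ∷ v ∷ t ∷ []
      N[w]≐ Awt Avt x≢t = neighbourhood-listed deg ≤-refl
        ((Adj⇒≢ Axy ∷ Adj⇒≢ Axv ∷ x≢t ∷ []) ∷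
         (∈∧∉⇒≢ y∈S v∉S ∷ (Adj-≢ Avt (¬Ayv ∘ Adj-sym) ∘ sym) ∷ []) ∷
         (Adj⇒≢ Avt ∷ []) ∷ [] ∷ [])
        (Adj-sym Axw ∷ Adj-sym Ayw ∷ Adj-sym Avw ∷ Awt ∷ [])
    ... | here u≡x                         = ∈∧∉⇒≢ x∈S u∉S (sym u≡x)
    ... | there (here u≡y)                 = ∈∧∉⇒≢ y∈S u∉S (sym u≡y)
    ... | there (there (here u≡v))         = Adj-≢ Ayu ¬Ayv u≡v
    ... | there (there (there (here refl))) = ¬octahedron (octahedral conn Avw Auw (Adj-sym Avt))

    module _ (¬Auw : ¬ Adj G u w) where

      ¬Inner-ear-xy : ∀ {q} → IsClique G q → q ≢ S → x ∈ q → y ∈ q → ¬ Inner G q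
      ¬Inner-ear-xy {q} q-clique q≢S x∈q y∈q q-inner@(q-triangle , _)
        with triangle-listed q-triangle x∈q y∈q (Adj⇒≢ Axy)
      ... | r , q≐ with triangle-edges (proj₁ q-triangle) q≐ | distinct q≐ | sound q≐
      ... | _ , Axr , Ayr | _ ∷ (y≢r ∷ []) ∷ _ | _ ∷ _ ∷ r∈q ∷ [] with listed-neighbour N[x]≐ Axr
      ... | here refl                         = y≢r refl
      ... | there (here refl)                 =
        q≢S (clique-⊆-complete q-clique (proj₁ S-clique) (S∋ ∘ complete q≐))
      ... | there (there (here refl))         = ¬Ayv Ayr
      ... | there (there (there (here refl))) = private-edge⇒¬Inner y∈q r∈q (Adj⇒≢ Ayw) yw-private q-inner
        where
        yw-private : ∀ {s} → Adj G y s → Adj G w s → s ∈ q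
        yw-private Ays Aws with listed-neighbour N[y]≐ Ays
        ... | here refl                         = x∈q
        ... | there (here refl)                 = ⊥-elim (¬Azw (Adj-sym Aws))
        ... | there (there (here refl))         = ⊥-elim (Adj⇒≢ Aws refl)
        ... | there (there (there (here refl))) = ⊥-elim (¬Auw (Adj-sym Aws))

      ¬Inner-ear-yz : ∀ {q} → IsClique G q → q ≢ S → y ∈ q → z ∈ q → ¬ Inner G q
      ¬Inner-ear-yz {q} q-clique q≢S y∈q z∈q q-inner@(q-triangle , _)
        with triangle-listed q-triangle y∈q z∈q (Adj⇒≢ Ayz)
      ... | r , q≐ with triangle-edges (proj₁ q-triangle) q≐ | distinct q≐ | sound q≐
      ... | _ , Ayr , Azr | _ ∷ (z≢r ∷ []) ∷ _ | _ ∷ _ ∷ r∈q ∷ [] with listed-neighbour N[y]≐ Ayr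
      ... | here refl                         =
        q≢S (clique-⊆-complete q-clique (proj₁ S-clique) (S∋ ∘ rotate ∘ complete q≐))
        where
        rotate : ∀ {s} → s ∈ₗ y ∷ z ∷ x ∷ [] → s ∈ₗ x ∷ y ∷ z ∷ []
        rotate (here s≡y)                 = there (here s≡y)
        rotate (there (here s≡z))         = there (there (here s≡z))
        rotate (there (there (here s≡x))) = here s≡x
      ... | there (here refl)                 = z≢r refl
      ... | there (there (here refl))         = ¬Azw Azr
      ... | there (there (there (here refl))) = private-edge⇒¬Inner y∈q r∈q (Adj⇒≢ Ayu) yu-private q-inner
        where
        yu-private : ∀ {s} → Adj G y s → Adj G u s → s ∈ q
        yu-private Ays Aus with listed-neighbour N[y]≐ Ays
        ... | here refl                         = ⊥-elim (¬Axu (Adj-sym Aus))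
        ... | there (here refl)                 = z∈q
        ... | there (there (here refl))         = ⊥-elim (¬Auw Aus)
        ... | there (there (there (here refl))) = ⊥-elim (Adj⇒≢ Aus refl)

      Sxz-clique : IsClique G Sxz
      Sxz-clique = listed-clique Sxz-complete Sxz≐ no-common-neighbour
        where
        no-common-neighbour : ∀ r → ¬ All (Adj G r) (x ∷ z ∷ v ∷ [])
        no-common-neighbour r (Arx ∷ Arz ∷ Arv ∷ []) with listed-neighbour N[x]≐ (Adj-sym Arx)
        ... | here refl                         = ¬Ayv Arv
        ... | there (here refl)                 = Adj⇒≢ Arz refl
        ... | there (there (here refl))         = Adj⇒≢ Arv refl
        ... | there (there (there (here refl))) = ¬Azw (Adj-sym Arz)

      y-clique-meets-Sxz : ∀ {q} → IsClique G q → y ∈ q → Nonempty (q ∩ Sxz)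
      y-clique-meets-Sxz {q} q-clique@(q-complete , _) y∈q with u ∈? q
      ... | yes u∈q = z , x∈p∩q⁺ (clique-absorbs q-clique z-sees , z∈Sxz)
        where
        x≢u = ∈∧∉⇒≢ x∈S u∉S
        u≢w = Adj-≢ Azu ¬Azw
        z∈Sxz = All.lookup (sound Sxz≐) (there (here refl))
        z-sees : ∀ {s} → s ∈ q → s ≢ z → Adj G z s
        z-sees {s} s∈q s≢z with s ≟ y
        ... | yes refl = Adj-sym Ayz
        ... | no  s≢y with listed-neighbour N[y]≐ (q-complete _ _ y∈q s∈q (s≢y ∘ sym))
        ...   | here refl                         = ⊥-elim (¬Axu (q-complete _ _ s∈q u∈q x≢u))
        ...   | there (here refl)                 = ⊥-elim (s≢z refl)
        ...   | there (there (here refl))         = ⊥-elim (¬Auw (q-complete _ _ u∈q s∈q u≢w))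
        ...   | there (there (there (here refl))) = Azu
      ... | no u∉q = x , x∈p∩q⁺ (clique-absorbs q-clique x-sees , x∈Sxz)
        where
        x∈Sxz = All.lookup (sound Sxz≐) (here refl)
        x-sees : ∀ {s} → s ∈ q → s ≢ x → Adj G x s
        x-sees {s} s∈q s≢x with s ≟ y
        ... | yes refl = Axy
        ... | no  s≢y with listed-neighbour N[y]≐ (q-complete _ _ y∈q s∈q (s≢y ∘ sym))
        ...   | here refl                         = ⊥-elim (s≢x refl)
        ...   | there (here refl)                 = Axz
        ...   | there (there (here refl))         = Axw
        ...   | there (there (there (here refl))) = ⊥-elim (u∉q s∈q)

      -- Sxz meets every clique through y, so adding it to the star of y keeps it a complete set of K(G).
      ¬Normal-y : ¬ Normal G y
      ¬Normal-y (_ , star-maximal) =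
        y∉Sxz (proj₂ (star-maximal star+Sxz (λ _ → inj₁) star+Sxz-complete Sxz (inj₂ refl)))
        where
        star+Sxz : Subset n → Set
        star+Sxz q = star G y q ⊎ q ≡ Sxz
        star+Sxz-complete : KComplete G star+Sxz
        star+Sxz-complete = cliques , meets
          where
          cliques : ∀ q → star+Sxz q → IsClique G q
          cliques _ (inj₁ (q-clique , _)) = q-clique
          cliques _ (inj₂ refl)           = Sxz-clique
          meets : ∀ q q' → star+Sxz q → star+Sxz q' → q ≢ q' → Nonempty (q ∩ q')
          meets _ _ (inj₁ (_ , y∈q))       (inj₁ (_ , y∈q'))       _    = y , x∈p∩q⁺ (y∈q , y∈q')
          meets _ _ (inj₁ (q-clique , y∈q)) (inj₂ refl)             _    = y-clique-meets-Sxz q-clique y∈q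
          meets q _ (inj₂ refl)             (inj₁ (q'-clique , y∈q')) _  =
            subst Nonempty (∩-comm _ Sxz) (y-clique-meets-Sxz q'-clique y∈q')
          meets _ _ (inj₂ refl)             (inj₂ refl)             q≢q' = ⊥-elim (q≢q' refl)
        y∉Sxz : y ∉ Sxz
        y∉Sxz y∈Sxz with complete Sxz≐ y∈Sxz
        ... | here y≡x                 = Adj⇒≢ Axy (sym y≡x)
        ... | there (here y≡z)         = Adj⇒≢ Ayz y≡z
        ... | there (there (here y≡v)) = ∈∧∉⇒≢ y∈S v∉S y≡v

  module BothSides (deg : MaxDegree≤ G 4) {S x} (F : Frame S x) where
    open Frame F
    private
      module A = FrameLemmas deg F
      module M = FrameLemmas deg (mirror F)

    u-misses-w-and-v : Connected G → ¬ IsOctahedron G → ∀ {S'} → Inner G S' → S' ≐ x ∷ v ∷ w ∷ [] →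
      ¬ Adj G u w × ¬ Adj G u v
    u-misses-w-and-v conn ¬octahedron S'-inner S'≐ =
      A.u-misses-w conn ¬octahedron S'-inner S'≐ , M.u-misses-w conn ¬octahedron S'-inner (≐-swap₂₃ S'≐)

    ears-¬Inner : ¬ Adj G u w → ¬ Adj G u v → ∀ q → Ear G S q → ¬ Inner G q
    ears-¬Inner ¬Auw ¬Auv q (q-clique , 2≤∣q∩S∣ , q≢S) with two-elements 2≤∣q∩S∣
    ... | a , b , a∈q∩S , b∈q∩S , a≢b with x∈p∩q⁻ q S a∈q∩S | x∈p∩q⁻ q S b∈q∩S
    ... | a∈q , a∈S | b∈q , b∈S with complete S≐ a∈S | complete S≐ b∈S
    ... | here refl                 | there (here refl)         = A.¬Inner-ear-xy ¬Auw q-clique q≢S a∈q b∈q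
    ... | there (here refl)         | here refl                 = A.¬Inner-ear-xy ¬Auw q-clique q≢S b∈q a∈q
    ... | here refl                 | there (there (here refl)) = M.¬Inner-ear-xy ¬Auv q-clique q≢S a∈q b∈q
    ... | there (there (here refl)) | here refl                 = M.¬Inner-ear-xy ¬Auv q-clique q≢S b∈q a∈q
    ... | there (here refl)         | there (there (here refl)) = A.¬Inner-ear-yz ¬Auw q-clique q≢S a∈q b∈q
    ... | there (there (here refl)) | there (here refl)         = A.¬Inner-ear-yz ¬Auw q-clique q≢S b∈q a∈q
    ... | here refl                 | here refl                 = ⊥-elim (a≢b refl)
    ... | there (here refl)         | there (here refl)         = ⊥-elim (a≢b refl)
    ... | there (there (here refl)) | there (there (here refl)) = ⊥-elim (a≢b refl)

    others-¬Normal : ¬ Adj G u w → ¬ Adj G u v → ∀ r → r ∈ S → r ≢ x → ¬ Normal G r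
    others-¬Normal ¬Auw ¬Auv r r∈S r≢x with complete S≐ r∈S
    ... | here r≡x                  = ⊥-elim (r≢x r≡x)
    ... | there (here refl)         = A.¬Normal-y ¬Auw
    ... | there (there (here refl)) = M.¬Normal-y ¬Auv

mainTheorem7 : ∀ {n} (G : Graph n) → Connected G → MaxDegree≤ G 4 → ¬ IsOctahedron G →
    ∀ (S S' : Subset n) (x : Fin n) → Triangle G S → Triangle G S' → (S ∩ S') ≡ ⁅ x ⁆ →
    Inner G S →
    NbhdInducesC4 G x ×
    (Inner G S' →
      (∀ q → Ear G S q → ¬ Inner G q) × (∀ y → y ∈ S → y ≢ x → ¬ Normal G y))
mainTheorem7 G conn deg ¬octahedron S S' x _ S'-triangle S∩S'≡x S-inner =
  N[x]-4-cycle Avw , λ S'-inner →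
    let ¬Auw , ¬Auv = u-misses-w-and-v conn ¬octahedron S'-inner S'≐
    in ears-¬Inner ¬Auw ¬Auv , others-¬Normal ¬Auw ¬Auv
  where
  F = frame G S-inner (proj₁ (∩≡⁅x⁆⇒x∈ S∩S'≡x))
  open FrameLemmas G deg F using (second-triangle-listed; N[x]-4-cycle)
  open BothSides G deg F
  S'≐ = second-triangle-listed S'-triangle S∩S'≡x
  Avw = proj₂ (proj₂ (triangle-edges G (proj₁ S'-triangle) S'≐))
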